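{- Let $G$ be a finite simple graph containing no induced chordless cycle on 4 vertices and in which $|F_e|\le 3$ for every edge $e$. Let $u,v,w$ be an induced path on 3 vertices in $G$, and define $A,B,C,D$, $B_i$, $E_i$ and $j$ as in the context. Then $|E_i|\le |E_{i-1}|$ for every integer $i$ with $1\le i\le j$; that is, $|E_j|\le |E_{j-1}|\le\cdots\le |E_0|$ (and, if $j=\infty$, $|E_i|\le|E_{i-1}|$ for all $i\ge 1$).
   Context: For an edge $e$ of $G$, $F_e$ is the set of all edges $e'$ of $G$ such that $V(e)\cup V(e')$ induces a path on 3 vertices in $G$. Let $u,v,w$ be an induced path on 3 vertices ($uv,vw\in E(G)$, $uw\notin E(G)$) and $A=\{u,v,w\}$. Let $B$ be the set of vertices not in $A$ having exactly one or two neighbors in $A$; $C$ the set of vertices having three neighbors in $A$; $D$ the set of vertices not in $A\cup B\cup C$ having at least one neighbor in $C$. For $i\ge 1$, $B_i$ is the set of vertices $x\notin A\cup B\cup C\cup D$ whose minimum distance in $G$ to a vertex of $B$ is exactly $i$; also $B_0=B$. For $i\ge 0$, $E_i$ is the set of edges with one endpoint in $B_i$ and the other in $B_{i+1}$. $j$ is the minimum index $i\ge 0$ such that some edge $e\in E_i$ has $|F_e|\ge 3$; if no such index exists, $j=\infty$. -}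

module Defs where

open import Data.Nat using (ℕ; zero; suc; _<_)
open import Data.Bool using (Bool; true; false; T; T?)
import Data.Bool.Properties as BoolP
open import Data.Fin using (Fin; toℕ) renaming (_<_ to _<ᶠ_)
open import Data.Fin.Properties using (_≟_; any?; all?) renaming (_<?_ to _<ᶠ?_)
open import Data.Fin.Subset using (Subset; ⁅_⁆; _∪_; _∩_; _∈_; _∉_; ∣_∣)
open import Data.Fin.Subset.Properties using (_∈?_)
open import Data.Vec using (tabulate)
open import Data.Vec.Properties using (≡-dec)
open import Data.List using (List; []; _∷_; filter; length; cartesianProduct; allFin)
open import Data.Product using (Σ; ∃; _×_; _,_)
open import Data.Sum using (_⊎_)
open import Relation.Binary.PropositionalEquality using (_≡_; _≢_)
open import Relation.Nullary using (¬_; Dec; yes; no)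
open import Relation.Nullary.Decidable using (_×-dec_; _⊎-dec_; ¬?)
open import Relation.Unary using (Decidable)
import Data.Nat.Properties as ℕP

record Graph (n : ℕ) : Set where
  field
    adj    : Fin n → Fin n → Bool
    sym    : ∀ x y → adj x y ≡ adj y x
    irrefl : ∀ x → adj x x ≡ false

module _ {n : ℕ} (G : Graph n) where
  open Graph G

  Adj : Fin n → Fin n → Set
  Adj x y = T (adj x y)

  Adj? : ∀ x y → Dec (Adj x y)
  Adj? x y = T? (adj x y)

  -- Edges of G: an edge {x,y} is represented by the pair (x , y) with x < y.
  IsEdge : Fin n × Fin n → Set
  IsEdge (x , y) = x <ᶠ y × Adj x y

  isEdge? : Decidable IsEdge
  isEdge? (x , y) = (x <ᶠ? y) ×-dec Adj? x y

  edges : List (Fin n × Fin n)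
  edges = filter isEdge? (cartesianProduct (allFin n) (allFin n))

  V : Fin n × Fin n → Subset n
  V (x , y) = ⁅ x ⁆ ∪ ⁅ y ⁆

  InducesP3 : Subset n → Set
  InducesP3 S = ∃ λ p → ∃ λ q → ∃ λ r →
    p ≢ q × q ≢ r × p ≢ r × S ≡ (⁅ p ⁆ ∪ ⁅ q ⁆) ∪ ⁅ r ⁆ ×
    Adj p q × Adj q r × ¬ Adj p r

  inducesP3? : Decidable InducesP3
  inducesP3? S = any? λ p → any? λ q → any? λ r →
    ¬? (p ≟ q) ×-dec ¬? (q ≟ r) ×-dec ¬? (p ≟ r) ×-dec
    ≡-dec BoolP._≟_ S ((⁅ p ⁆ ∪ ⁅ q ⁆) ∪ ⁅ r ⁆) ×-dec
    Adj? p q ×-dec Adj? q r ×-dec ¬? (Adj? p r)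

  cardF : Fin n × Fin n → ℕ
  cardF e = length (filter (λ e' → inducesP3? (V e ∪ V e')) edges)

  InducedC4 : Fin n → Fin n → Fin n → Fin n → Set
  InducedC4 a b c d =
    a ≢ c × b ≢ d ×
    Adj a b × Adj b c × Adj c d × Adj d a × ¬ Adj a c × ¬ Adj b d

  C4Free : Set
  C4Free = ∀ a b c d → ¬ InducedC4 a b c d

  N : Fin n → Subset n
  N x = tabulate (adj x)

  module Layers (u v w : Fin n) where

    A : Subset n
    A = (⁅ u ⁆ ∪ ⁅ v ⁆) ∪ ⁅ w ⁆

    nbA : Fin n → ℕ
    nbA x = ∣ N x ∩ A ∣

    InA : Fin n → Set
    InA x = x ∈ A

    InB : Fin n → Set
    InB x = x ∉ A × (nbA x ≡ 1 ⊎ nbA x ≡ 2)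

    inB? : Decidable InB
    inB? x = ¬? (x ∈? A) ×-dec (nbA x ℕP.≟ 1 ⊎-dec nbA x ℕP.≟ 2)

    InC : Fin n → Set
    InC x = nbA x ≡ 3

    inC? : Decidable InC
    inC? x = nbA x ℕP.≟ 3

    InD : Fin n → Set
    InD x = x ∉ A × ¬ InB x × ¬ InC x × ∃ λ c → InC c × Adj x c

    inD? : Decidable InD
    inD? x = ¬? (x ∈? A) ×-dec ¬? (inB? x) ×-dec ¬? (inC? x) ×-dec
             any? (λ c → inC? c ×-dec Adj? x c)

    WalkToB : ℕ → Fin n → Set
    WalkToB zero x = InB x
    WalkToB (suc k) x = ∃ λ y → Adj x y × WalkToB k y

    walkToB? : ∀ k → Decidable (WalkToB k)
    walkToB? zero x = inB? x
    walkToB? (suc k) x = any? λ y → Adj? x y ×-dec walkToB? k y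

    DistB : ℕ → Fin n → Set
    DistB k x = WalkToB k x × (∀ (l : Fin k) → ¬ WalkToB (toℕ l) x)

    distB? : ∀ k → Decidable (DistB k)
    distB? k x = walkToB? k x ×-dec all? (λ l → ¬? (walkToB? (toℕ l) x))

    InBi : ℕ → Fin n → Set
    InBi zero x = InB x
    InBi (suc i) x = x ∉ A × ¬ InB x × ¬ InC x × ¬ InD x × DistB (suc i) x

    inBi? : ∀ i → Decidable (InBi i)
    inBi? zero x = inB? x
    inBi? (suc i) x = ¬? (x ∈? A) ×-dec ¬? (inB? x) ×-dec ¬? (inC? x) ×-dec
                      ¬? (inD? x) ×-dec distB? (suc i) x

    InE : ℕ → Fin n × Fin n → Set
    InE i (x , y) = IsEdge (x , y) × ((InBi i x × InBi (suc i) y) ⊎ (InBi (suc i) x × InBi i y))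

    inE? : ∀ i → Decidable (InE i)
    inE? i (x , y) = isEdge? (x , y) ×-dec
      ((inBi? i x ×-dec inBi? (suc i) y) ⊎-dec (inBi? (suc i) x ×-dec inBi? i y))

    cardE : ℕ → ℕ
    cardE i = length (filter (inE? i) edges)

    -- "i ≤ j": no index k < i has an edge e ∈ E_k with |F_e| ≥ 3
    -- (j = min such index, j = ∞ if none)
    AtMostJ : ℕ → Set
    AtMostJ i = ∀ k → k < i → ∀ e → InE k e → cardF e < 3

{-# OPTIONS --safe #-}

-- Send an edge ab of E_{i+1}, with a ∈ B_{i+1} and b ∈ B_{i+2}, to an edge az of E_i with z ∈ B_i.
-- Such a z exists because a vertex outside A ∪ B ∪ C ∪ D has no neighbour z ∈ D: for a neighbour
-- c ∈ C of z, F_{cz} would contain cu, cv, cw and za, against |F_{cz}| ≤ 3. The map is injective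
-- while i < j: two edges ab₁, ab₂ with the same image az would put ab₁, ab₂ and an edge zz′
-- leading from z back towards A into F_{az}.

module Submission where

open import Defs

import Algebra.Solver.IdempotentCommutativeMonoid as ∪-Solver
open import Data.Bool using (T)
open import Data.Bool.Properties using (T-≡)
open import Data.Empty using (⊥; ⊥-elim)
open import Data.Fin using (Fin; fromℕ<) renaming (_<_ to _<ᶠ_)
open import Data.Fin.Properties using (<-cmp; <-asym; any?; _≟_; toℕ<n; toℕ-fromℕ<)
open import Data.Fin.Subset using (Subset; ⁅_⁆; _∪_; _∩_; _-_; _∈_; _∉_; _⊆_; ∣_∣; inside; outside)
open import Data.Fin.Subset.Properties
  using ( x∈⁅x⁆; x∈p∪q⁺; x∈p∩q⁺; x∈p∩q⁻; x∈p∧x≢y⇒x∈p-y; p⊆q⇒∣p∣≤∣q∣; x∈p⇒∣p-x∣<∣p∣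
        ; x∈⁅y⁆⇒x≡y; ∣⁅x⁆∣≡1; ∣p∩q∣≤∣q∣; ∣⊥∣≡0; nonempty?; Empty-unique; ∪-comm
        ; ∪-idempotentCommutativeMonoid )
open import Data.List using (List; []; _∷_; _++_; length; filter)
open import Data.List.Membership.Propositional using () renaming (_∈_ to _∈ₗ_)
open import Data.List.Membership.Propositional.Properties
  using (∈-∃++; ∈-++⁻; ∈-++⁺ˡ; ∈-++⁺ʳ; ∈-filter⁺; ∈-filter⁻; ∈-cartesianProduct⁺; ∈-allFin)
open import Data.List.Properties using (length-++-sucʳ)
open import Data.List.Relation.Unary.All as All using ([]; _∷_)
open import Data.List.Relation.Unary.AllPairs using ([]; _∷_)
open import Data.List.Relation.Unary.Any using (here; there)
open import Data.List.Relation.Unary.Unique.Propositional using (Unique)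
import Data.List.Relation.Unary.Unique.Propositional.Properties as Unique
open import Data.Nat using (ℕ; zero; suc; _+_; _≤_; _<_; z≤n; s≤s)
open import Data.Nat.Properties
  using (0≢1+n; ≤-trans; ≤-reflexive; +-suc; n≤1+n; +-mono-≤; <⇒≱; <-irrefl; n<1+n; m<n⇒m<1+n; module ≤-Reasoning)
open import Data.Product using (_×_; _,_; proj₁; proj₂; ∃-syntax; swap)
open import Data.Product.Properties using (,-injective)
open import Data.Sum using (_⊎_; inj₁; inj₂; [_,_]′)
open import Data.Vec using ([]; _∷_)
open import Data.Vec.Properties using (lookup∘tabulate; lookup⇒[]=; []=⇒lookup)
open import Function using (id; Equivalence)
open import Relation.Binary using (tri<; tri≈; tri>)
open import Relation.Binary.PropositionalEquality
open import Relation.Nullary using (¬_; yes; no)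
open import Relation.Nullary.Decidable using (_×-dec_; decidable-stable)
open import Relation.Nullary.Negation using (contradiction)

private
  variable
    X Y : Set
    n : ℕ

module _ (f : X → Y) where

  injection⇒length-≤ : ∀ {xs ys} → Unique xs → (∀ {x} → x ∈ₗ xs → f x ∈ₗ ys) →
                       (∀ {x y} → x ∈ₗ xs → y ∈ₗ xs → f x ≡ f y → x ≡ y) →
                       length xs ≤ length ys
  injection⇒length-≤ {[]}     _               _    _   = z≤n
  injection⇒length-≤ {x ∷ xs} (x∉xs ∷ xs-uniq) maps inj with ∈-∃++ (maps (here refl))
  ... | ys₁ , ys₂ , refl = begin
    suc (length xs)              ≤⟨ s≤s (injection⇒length-≤ xs-uniq maps′ (λ p q → inj (there p) (there q))) ⟩
    suc (length (ys₁ ++ ys₂))    ≡⟨ length-++-sucʳ ys₁ (f x) ys₂ ⟨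
    length (ys₁ ++ f x ∷ ys₂)    ∎
    where
    open ≤-Reasoning
    maps′ : ∀ {y} → y ∈ₗ xs → f y ∈ₗ ys₁ ++ ys₂
    maps′ {y} y∈xs with ∈-++⁻ ys₁ (maps (there y∈xs))
    ... | inj₁ fy∈ys₁        = ∈-++⁺ˡ fy∈ys₁
    ... | inj₂ (here fy≡fx)  = contradiction (sym (inj (there y∈xs) (here refl) fy≡fx)) (All.lookup x∉xs y∈xs)
    ... | inj₂ (there fy∈ys₂) = ∈-++⁺ʳ ys₁ fy∈ys₂

Unique-⊆⇒length-≤ : ∀ {xs ys : List X} → Unique xs → (∀ {x} → x ∈ₗ xs → x ∈ₗ ys) → length xs ≤ length ys
Unique-⊆⇒length-≤ xs-uniq sub = injection⇒length-≤ id xs-uniq sub (λ _ _ eq → eq)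

∣p∪q∣≤∣p∣+∣q∣ : (p q : Subset n) → ∣ p ∪ q ∣ ≤ ∣ p ∣ + ∣ q ∣
∣p∪q∣≤∣p∣+∣q∣ []            []            = z≤n
∣p∪q∣≤∣p∣+∣q∣ (outside ∷ p) (outside ∷ q) = ∣p∪q∣≤∣p∣+∣q∣ p q
∣p∪q∣≤∣p∣+∣q∣ (inside  ∷ p) (outside ∷ q) = s≤s (∣p∪q∣≤∣p∣+∣q∣ p q)
∣p∪q∣≤∣p∣+∣q∣ (outside ∷ p) (inside  ∷ q) =
  ≤-trans (s≤s (∣p∪q∣≤∣p∣+∣q∣ p q)) (≤-reflexive (sym (+-suc ∣ p ∣ ∣ q ∣)))
∣p∪q∣≤∣p∣+∣q∣ (inside  ∷ p) (inside  ∷ q) =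
  s≤s (≤-trans (∣p∪q∣≤∣p∣+∣q∣ p q) (≤-trans (n≤1+n _) (≤-reflexive (sym (+-suc ∣ p ∣ ∣ q ∣)))))

∣⁅x⁆∪⁅y⁆∣≤2 : (x y : Fin n) → ∣ ⁅ x ⁆ ∪ ⁅ y ⁆ ∣ ≤ 2
∣⁅x⁆∪⁅y⁆∣≤2 x y = ≤-trans (∣p∪q∣≤∣p∣+∣q∣ ⁅ x ⁆ ⁅ y ⁆) (≤-reflexive (cong₂ _+_ (∣⁅x⁆∣≡1 x) (∣⁅x⁆∣≡1 y)))

∣⁅x⁆∪⁅y⁆∪⁅z⁆∣≤3 : (x y z : Fin n) → ∣ (⁅ x ⁆ ∪ ⁅ y ⁆) ∪ ⁅ z ⁆ ∣ ≤ 3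
∣⁅x⁆∪⁅y⁆∪⁅z⁆∣≤3 x y z = ≤-trans (∣p∪q∣≤∣p∣+∣q∣ (⁅ x ⁆ ∪ ⁅ y ⁆) ⁅ z ⁆)
  (+-mono-≤ (∣⁅x⁆∪⁅y⁆∣≤2 x y) (≤-reflexive (∣⁅x⁆∣≡1 z)))

3≤∣⁅x⁆∪⁅y⁆∪⁅z⁆∣⇒distinct : {x y z : Fin n} → 3 ≤ ∣ (⁅ x ⁆ ∪ ⁅ y ⁆) ∪ ⁅ z ⁆ ∣ → x ≢ y × y ≢ z × x ≢ z
3≤∣⁅x⁆∪⁅y⁆∪⁅z⁆∣⇒distinct {n} {x} {y} {z} 3≤ =
    (λ { refl → too-small x z (solve 2 (λ x z → (x ⊕ x) ⊕ z ⊜ x ⊕ z) refl ⁅ x ⁆ ⁅ z ⁆) })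
  , (λ { refl → too-small x y (solve 2 (λ x y → (x ⊕ y) ⊕ y ⊜ x ⊕ y) refl ⁅ x ⁆ ⁅ y ⁆) })
  , (λ { refl → too-small x y (solve 2 (λ x y → (x ⊕ y) ⊕ x ⊜ x ⊕ y) refl ⁅ x ⁆ ⁅ y ⁆) })
  where
  open ∪-Solver (∪-idempotentCommutativeMonoid n)
  too-small : ∀ p q → (⁅ x ⁆ ∪ ⁅ y ⁆) ∪ ⁅ z ⁆ ≡ ⁅ p ⁆ ∪ ⁅ q ⁆ → ⊥
  too-small p q eq = <⇒≱ (n<1+n 2) (≤-trans 3≤ (≤-trans (≤-reflexive (cong ∣_∣ eq)) (∣⁅x⁆∪⁅y⁆∣≤2 p q)))

-- The edge {x, y} as the sorted pair, the form in which IsEdge and edges represent it.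
edge : Fin n → Fin n → Fin n × Fin n
edge x y with <-cmp x y
... | tri< _ _ _ = x , y
... | tri≈ _ _ _ = x , y
... | tri> _ _ _ = y , x

edge-cases : (x y : Fin n) → edge x y ≡ (x , y) ⊎ edge x y ≡ (y , x)
edge-cases x y with <-cmp x y
... | tri< _ _ _ = inj₁ refl
... | tri≈ _ _ _ = inj₁ refl
... | tri> _ _ _ = inj₂ refl

edge-< : {x y : Fin n} → x <ᶠ y → edge x y ≡ (x , y)
edge-< {x = x} {y} x<y with <-cmp x y
... | tri< _ _ _    = refl
... | tri≈ _ _ _    = refl
... | tri> _ _ y<x  = contradiction y<x (<-asym x<y)

edge-> : {x y : Fin n} → y <ᶠ x → edge x y ≡ (y , x)
edge-> {x = x} {y} y<x with <-cmp x y
... | tri< x<y _ _  = contradiction y<x (<-asym x<y)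
... | tri≈ _ refl _ = refl
... | tri> _ _ _    = refl

edge-comm : (x y : Fin n) → edge x y ≡ edge y x
edge-comm x y with <-cmp x y
... | tri< x<y _ _  = sym (edge-> x<y)
... | tri≈ _ refl _ = [ sym , sym ]′ (edge-cases x x)
... | tri> _ _ y<x  = sym (edge-< y<x)

edge-injective : {x y p q : Fin n} → edge x y ≡ edge p q → (x ≡ p × y ≡ q) ⊎ (x ≡ q × y ≡ p)
edge-injective {x = x} {y} {p} {q} eq with edge-cases x y | edge-cases p q
... | inj₁ xy | inj₁ pq = inj₁ (,-injective (trans (sym xy) (trans eq pq)))
... | inj₁ xy | inj₂ qp = inj₂ (,-injective (trans (sym xy) (trans eq qp)))
... | inj₂ yx | inj₁ pq = inj₂ (swap (,-injective (trans (sym yx) (trans eq pq))))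
... | inj₂ yx | inj₂ qp = inj₁ (swap (,-injective (trans (sym yx) (trans eq qp))))

edge-≢ : {x y p q : Fin n} → x ≢ p → x ≢ q → edge x y ≢ edge p q
edge-≢ x≢p x≢q eq with edge-injective eq
... | inj₁ (x≡p , _) = x≢p x≡p
... | inj₂ (x≡q , _) = x≢q x≡q

edge-injectiveʳ : {x y y′ : Fin n} → edge x y ≡ edge x y′ → y ≡ y′
edge-injectiveʳ eq with edge-injective eq
... | inj₁ (_ , y≡y′)     = y≡y′
... | inj₂ (x≡y′ , y≡x)   = trans y≡x x≡y′

module _ (G : Graph n) where

  Adj-sym : ∀ {x y} → Adj G x y → Adj G y x
  Adj-sym {x} {y} = subst T (Graph.sym G x y)

  Adj-irrefl : ∀ {x y} → Adj G x y → x ≢ y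
  Adj-irrefl {x} xx refl = subst T (Graph.irrefl G x) xx

  Adj⇒∈N : ∀ {x y} → Adj G x y → y ∈ N G x
  Adj⇒∈N {x} {y} xy = lookup⇒[]= y _ (trans (lookup∘tabulate (Graph.adj G x) y) (Equivalence.to T-≡ xy))

  ∈N⇒Adj : ∀ {x y} → y ∈ N G x → Adj G x y
  ∈N⇒Adj {x} {y} y∈N = Equivalence.from T-≡ (trans (sym (lookup∘tabulate (Graph.adj G x) y)) ([]=⇒lookup y∈N))

  IsEdge-edge : ∀ {x y} → Adj G x y → IsEdge G (edge x y)
  IsEdge-edge {x} {y} xy with <-cmp x y
  ... | tri< x<y _ _ = x<y , xy
  ... | tri≈ _ x≡y _ = contradiction x≡y (Adj-irrefl xy)
  ... | tri> _ _ y<x = y<x , Adj-sym xy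

  IsEdge⇒∈edges : ∀ {e} → IsEdge G e → e ∈ₗ edges G
  IsEdge⇒∈edges = ∈-filter⁺ (isEdge? G) (∈-cartesianProduct⁺ (∈-allFin _) (∈-allFin _))

  edges-unique : Unique (edges G)
  edges-unique = Unique.filter⁺ (isEdge? G) (Unique.cartesianProduct⁺ (Unique.allFin⁺ n) (Unique.allFin⁺ n))

  V-edge : ∀ x y → V G (edge x y) ≡ ⁅ x ⁆ ∪ ⁅ y ⁆
  V-edge x y = [ cong (V G) , (λ eq → trans (cong (V G) eq) (∪-comm ⁅ y ⁆ ⁅ x ⁆)) ]′ (edge-cases x y)

  F : Fin n × Fin n → List (Fin n × Fin n)
  F e = filter (λ e′ → inducesP3? G (V G e ∪ V G e′)) (edges G)

  P3⇒∈F : ∀ {x y z} → Adj G x y → Adj G y z → x ≢ z → ¬ Adj G x z → edge y x ∈ₗ F (edge y z)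
  P3⇒∈F {x} {y} {z} xy yz x≢z ¬xz = ∈-filter⁺ (λ e′ → inducesP3? G (V G (edge y z) ∪ V G e′))
    (IsEdge⇒∈edges (IsEdge-edge (Adj-sym xy)))
    (x , y , z , Adj-irrefl xy , Adj-irrefl yz , x≢z , vertices , xy , yz , ¬xz)
    where
    open ∪-Solver (∪-idempotentCommutativeMonoid n)
    vertices : V G (edge y z) ∪ V G (edge y x) ≡ (⁅ x ⁆ ∪ ⁅ y ⁆) ∪ ⁅ z ⁆
    vertices = trans (cong₂ _∪_ (V-edge y z) (V-edge y x))
      (solve 3 (λ x y z → (y ⊕ z) ⊕ (y ⊕ x) ⊜ (x ⊕ y) ⊕ z) refl ⁅ x ⁆ ⁅ y ⁆ ⁅ z ⁆)

  module _ (u v w : Fin n) where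
    open Layers G u v w

    ∣A∣≤3 : ∣ A ∣ ≤ 3
    ∣A∣≤3 = ∣⁅x⁆∪⁅y⁆∪⁅z⁆∣≤3 u v w

    nbA≤3 : ∀ x → nbA x ≤ 3
    nbA≤3 x = ≤-trans (∣p∩q∣≤∣q∣ (N G x) A) ∣A∣≤3

    Adj-A⇒0<nbA : ∀ {x p} → p ∈ A → Adj G x p → 0 < nbA x
    Adj-A⇒0<nbA {x} {p} p∈A xp = ≤-trans (≤-reflexive (sym (∣⁅x⁆∣≡1 p))) (p⊆q⇒∣p∣≤∣q∣ ⁅p⁆⊆)
      where
      ⁅p⁆⊆ : ⁅ p ⁆ ⊆ N G x ∩ A
      ⁅p⁆⊆ y∈⁅p⁆ with x∈⁅y⁆⇒x≡y p y∈⁅p⁆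
      ... | refl = x∈p∩q⁺ (Adj⇒∈N xp , p∈A)

    Adj-A⇒InB⊎InC : ∀ {x p} → x ∉ A → p ∈ A → Adj G x p → InB x ⊎ InC x
    Adj-A⇒InB⊎InC {x} x∉A p∈A xp = classify (nbA x) refl (Adj-A⇒0<nbA p∈A xp) (nbA≤3 x)
      where
      classify : ∀ k → nbA x ≡ k → 0 < k → k ≤ 3 → InB x ⊎ InC x
      classify 1 eq _ _ = inj₁ (x∉A , inj₁ eq)
      classify 2 eq _ _ = inj₁ (x∉A , inj₂ eq)
      classify 3 eq _ _ = inj₂ eq
      classify (suc (suc (suc (suc _)))) _ _ (s≤s (s≤s (s≤s ())))

    InB⇒∃Adj-A : ∀ {x} → InB x → ∃[ p ] p ∈ A × Adj G x p
    InB⇒∃Adj-A {x} (_ , nbA≡1⊎2) with nonempty? (N G x ∩ A)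
    ... | yes (p , p∈) = p , proj₂ (x∈p∩q⁻ _ _ p∈) , ∈N⇒Adj (proj₁ (x∈p∩q⁻ _ _ p∈))
    ... | no empty = ⊥-elim ([ nbA≢ , nbA≢ ]′ nbA≡1⊎2)
      where
      nbA≢ : ∀ {k} → nbA x ≢ suc k
      nbA≢ eq = 0≢1+n (trans (sym (trans (cong ∣_∣ (Empty-unique empty)) (∣⊥∣≡0 n))) eq)

    InC⇒Adj : ∀ {c p} → InC c → p ∈ A → Adj G c p
    InC⇒Adj {c} {p} c∈C p∈A = decidable-stable (Adj? G c p) λ ¬cp → <-irrefl refl (begin-strict
      3          ≡⟨ c∈C ⟨
      nbA c      ≤⟨ p⊆q⇒∣p∣≤∣q∣ (avoids ¬cp) ⟩
      ∣ A - p ∣  <⟨ x∈p⇒∣p-x∣<∣p∣ p∈A ⟩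
      ∣ A ∣      ≤⟨ ∣A∣≤3 ⟩
      3          ∎)
      where
      open ≤-Reasoning
      avoids : ¬ Adj G c p → N G c ∩ A ⊆ A - p
      avoids ¬cp y∈ with x∈p∩q⁻ _ _ y∈
      ... | y∈N , y∈A = x∈p∧x≢y⇒x∈p-y y∈A λ { refl → ¬cp (∈N⇒Adj y∈N) }

    InC⇒distinct : ∀ {c} → InC c → u ≢ v × v ≢ w × u ≢ w
    InC⇒distinct {c} c∈C = 3≤∣⁅x⁆∪⁅y⁆∪⁅z⁆∣⇒distinct (≤-trans (≤-reflexive (sym c∈C)) (∣p∩q∣≤∣q∣ (N G c) A))

    InBi⇒WalkToB : ∀ {i x} → InBi i x → WalkToB i x
    InBi⇒WalkToB {zero}  x∈B                       = x∈B
    InBi⇒WalkToB {suc i} (_ , _ , _ , _ , walk , _) = walk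

    InBi⇒¬WalkToB : ∀ {i l x} → InBi i x → l < i → ¬ WalkToB l x
    InBi⇒¬WalkToB {suc i} {l} {x} (_ , _ , _ , _ , _ , noShorter) l<i walk =
      noShorter (fromℕ< l<i) (subst (λ k → WalkToB k x) (sym (toℕ-fromℕ< l<i)) walk)

    InBi-<⇒≢ : ∀ {i j x y} → InBi i x → InBi j y → i < j → x ≢ y
    InBi-<⇒≢ x∈Bi y∈Bj i<j refl = InBi⇒¬WalkToB y∈Bj i<j (InBi⇒WalkToB x∈Bi)

    InBi-<⇒¬Adj : ∀ {i j x y} → InBi i x → InBi j y → suc i < j → ¬ Adj G y x
    InBi-<⇒¬Adj x∈Bi y∈Bj 1+i<j yx = InBi⇒¬WalkToB y∈Bj 1+i<j (_ , yx , InBi⇒WalkToB x∈Bi)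

    4≤cardF : ∀ {z c a} → z ∉ A → ¬ InB z → ¬ InC z → InC c → Adj G z c →
              Adj G z a → c ≢ a → ¬ Adj G c a → 4 ≤ cardF G (edge c z)
    4≤cardF {z} {c} {a} z∉A ¬z∈B ¬z∈C c∈C zc za c≢a ¬ca with InC⇒distinct c∈C
    ... | u≢v , v≢w , u≢w =
      Unique-⊆⇒length-≤ {xs = edge c u ∷ edge c v ∷ edge c w ∷ edge z a ∷ []}
        ((spoke≢ u≢v ∷ spoke≢ u≢w ∷ spoke≢za ∷ []) ∷ (spoke≢ v≢w ∷ spoke≢za ∷ []) ∷ (spoke≢za ∷ []) ∷ [] ∷ [])
        λ { (here refl) → spoke u∈A
          ; (there (here refl)) → spoke v∈A
          ; (there (there (here refl))) → spoke w∈A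
          ; (there (there (there (here refl)))) → subst (edge z a ∈ₗ_) (cong F (edge-comm z c))
              (P3⇒∈F (Adj-sym za) zc (≢-sym c≢a) (λ ac → ¬ca (Adj-sym ac))) }
      where
      u∈A : u ∈ A
      u∈A = x∈p∪q⁺ (inj₁ (x∈p∪q⁺ (inj₁ (x∈⁅x⁆ u))))
      v∈A : v ∈ A
      v∈A = x∈p∪q⁺ (inj₁ (x∈p∪q⁺ (inj₂ (x∈⁅x⁆ v))))
      w∈A : w ∈ A
      w∈A = x∈p∪q⁺ (inj₂ (x∈⁅x⁆ w))
      spoke : ∀ {p} → p ∈ A → edge c p ∈ₗ F (edge c z)
      spoke p∈A = P3⇒∈F (Adj-sym (InC⇒Adj c∈C p∈A)) (Adj-sym zc) (λ { refl → z∉A p∈A })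
        λ pz → [ ¬z∈B , ¬z∈C ]′ (Adj-A⇒InB⊎InC z∉A p∈A (Adj-sym pz))
      spoke≢ : ∀ {p q} → p ≢ q → edge c p ≢ edge c q
      spoke≢ p≢q eq = p≢q (edge-injectiveʳ eq)
      spoke≢za : ∀ {p} → edge c p ≢ edge z a
      spoke≢za = edge-≢ (≢-sym (Adj-irrefl zc)) c≢a

    InE-edge : ∀ {j x y} → InBi (suc j) x → InBi j y → Adj G x y → InE j (edge x y)
    InE-edge {x = x} {y} x∈ y∈ xy with <-cmp x y
    ... | tri< x<y _ _ = (x<y , xy) , inj₂ (x∈ , y∈)
    ... | tri≈ _ x≡y _ = contradiction x≡y (Adj-irrefl xy)
    ... | tri> _ _ y<x = (y<x , Adj-sym xy) , inj₁ (y∈ , x∈)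

    back-neighbour : ∀ {i z} → InBi i z →
                     ∃[ z′ ] Adj G z z′ × (∀ {a} → InBi (suc i) a → z′ ≢ a × ¬ Adj G z′ a)
    back-neighbour {zero} z∈B with InB⇒∃Adj-A z∈B
    ... | p , p∈A , zp = p , zp , λ (a∉A , ¬a∈B , ¬a∈C , _) →
      (λ { refl → a∉A p∈A }) , λ pa → [ ¬a∈B , ¬a∈C ]′ (Adj-A⇒InB⊎InC a∉A p∈A (Adj-sym pa))
    back-neighbour {suc i} (_ , _ , _ , _ , (z′ , zz′ , walk) , _) = z′ , zz′ , λ a∈ →
      (λ { refl → InBi⇒¬WalkToB a∈ (m<n⇒m<1+n (n<1+n i)) walk }) ,
      λ z′a → InBi⇒¬WalkToB a∈ (n<1+n (suc i)) (z′ , Adj-sym z′a , walk)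

    3≤cardF : ∀ {i z a b₁ b₂} → InBi i z → InBi (suc i) a → Adj G a z →
              InBi (suc (suc i)) b₁ → InBi (suc (suc i)) b₂ → Adj G a b₁ → Adj G a b₂ → b₁ ≢ b₂ →
              3 ≤ cardF G (edge a z)
    3≤cardF {i} {z} {a} {b₁} {b₂} z∈ a∈ az b₁∈ b₂∈ ab₁ ab₂ b₁≢b₂ with back-neighbour z∈
    ... | z′ , zz′ , far =
      Unique-⊆⇒length-≤ {xs = edge z z′ ∷ edge a b₁ ∷ edge a b₂ ∷ []}
        ((back≢ b₁∈ ∷ back≢ b₂∈ ∷ []) ∷ ((λ eq → b₁≢b₂ (edge-injectiveʳ eq)) ∷ []) ∷ [] ∷ [])
        λ { (here refl) → subst (edge z z′ ∈ₗ_) (cong F (edge-comm z a))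
              (P3⇒∈F (Adj-sym zz′) (Adj-sym az) (proj₁ (far a∈)) (proj₂ (far a∈)))
          ; (there (here refl)) → forward b₁∈ ab₁
          ; (there (there (here refl))) → forward b₂∈ ab₂ }
      where
      back≢ : ∀ {b} → InBi (suc (suc i)) b → edge z z′ ≢ edge a b
      back≢ b∈ = edge-≢ (InBi-<⇒≢ z∈ a∈ (n<1+n i)) (InBi-<⇒≢ z∈ b∈ (m<n⇒m<1+n (n<1+n i)))
      forward : ∀ {b} → InBi (suc (suc i)) b → Adj G a b → edge a b ∈ₗ F (edge a z)
      forward b∈ ab = P3⇒∈F (Adj-sym ab) az (≢-sym (InBi-<⇒≢ z∈ b∈ (m<n⇒m<1+n (n<1+n i))))
        (InBi-<⇒¬Adj z∈ b∈ (n<1+n (suc i)))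

    module _ (cardF≤3 : ∀ e → IsEdge G e → cardF G e ≤ 3) where

      Outside⇒¬Adj-D : ∀ {a z} → a ∉ A → ¬ InB a → ¬ InC a → ¬ InD a → InD z → ¬ Adj G a z
      Outside⇒¬Adj-D a∉A ¬a∈B ¬a∈C ¬a∈D (z∉A , ¬z∈B , ¬z∈C , c , c∈C , zc) az =
        <⇒≱ (n<1+n 3) (≤-trans
          (4≤cardF z∉A ¬z∈B ¬z∈C c∈C zc (Adj-sym az) (λ { refl → ¬a∈C c∈C })
             (λ ca → ¬a∈D (a∉A , ¬a∈B , ¬a∈C , _ , c∈C , Adj-sym ca)))
          (cardF≤3 _ (IsEdge-edge (Adj-sym zc))))

      lower-neighbour : ∀ {i a} → InBi (suc i) a → ∃[ z ] InBi i z × Adj G a z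
      lower-neighbour {zero} (_ , _ , _ , _ , (z , az , z∈B) , _) = z , z∈B , az
      lower-neighbour {suc i} a∈@(a∉A , ¬a∈B , ¬a∈C , ¬a∈D , (z , az , walk) , _) =
        z , ( (λ z∈A → [ ¬a∈B , ¬a∈C ]′ (Adj-A⇒InB⊎InC a∉A z∈A az))
            , (λ z∈B → InBi⇒¬WalkToB a∈ (s≤s (s≤s z≤n)) (z , az , z∈B))
            , (λ z∈C → ¬a∈D (a∉A , ¬a∈B , ¬a∈C , z , z∈C , az))
            , (λ z∈D → Outside⇒¬Adj-D a∉A ¬a∈B ¬a∈C ¬a∈D z∈D az)
            , walk , λ l walk′ → InBi⇒¬WalkToB a∈ (s≤s (toℕ<n l)) (z , az , walk′))
          , az

      module _ (i : ℕ) where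

        upper : Fin n × Fin n → Fin n
        upper (x , y) with inBi? (suc i) x
        ... | yes _ = x
        ... | no _  = y

        upper-spec : ∀ {e} → InE (suc i) e → InBi (suc i) (upper e) ×
                     ∃[ b ] InBi (suc (suc i)) b × Adj G (upper e) b × e ≡ edge (upper e) b
        upper-spec {x , y} ((x<y , xy) , inj₁ (x∈ , y∈)) with inBi? (suc i) x
        ... | yes _  = x∈ , y , y∈ , xy , sym (edge-< x<y)
        ... | no x∉  = contradiction x∈ x∉
        upper-spec {x , y} ((x<y , xy) , inj₂ (x∈ , y∈)) with inBi? (suc i) x
        ... | yes x∈′ = contradiction refl (InBi-<⇒≢ x∈′ x∈ (n<1+n (suc i)))
        ... | no _    = y∈ , x , x∈ , Adj-sym xy , sym (trans (edge-comm y x) (edge-< x<y))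

        -- The fallback a is a junk value: lower is only applied to vertices of B_{i+1}, which have a neighbour in B_i.
        lower : Fin n → Fin n
        lower a with any? (λ z → inBi? i z ×-dec Adj? G a z)
        ... | yes (z , _) = z
        ... | no _        = a

        lower-spec : ∀ {a} → InBi (suc i) a → InBi i (lower a) × Adj G a (lower a)
        lower-spec {a} a∈ with any? (λ z → inBi? i z ×-dec Adj? G a z)
        ... | yes (_ , spec) = spec
        ... | no none        = contradiction (lower-neighbour a∈) none

        descend : Fin n × Fin n → Fin n × Fin n
        descend e = edge (upper e) (lower (upper e))

        descend-InE : ∀ {e} → InE (suc i) e → InE i (descend e)
        descend-InE {e} ie = InE-edge a∈ (proj₁ (lower-spec a∈)) (proj₂ (lower-spec a∈))
          where
          a∈ : InBi (suc i) (upper e)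
          a∈ = proj₁ (upper-spec ie)

        upper-neighbour-unique : (∀ e → InE i e → cardF G e < 3) →
                                 ∀ {a b₁ b₂} → InBi (suc i) a → InBi (suc (suc i)) b₁ → InBi (suc (suc i)) b₂ →
                                 Adj G a b₁ → Adj G a b₂ → b₁ ≡ b₂
        upper-neighbour-unique F<3 a∈ b₁∈ b₂∈ ab₁ ab₂ with lower-neighbour a∈
        ... | z , z∈ , az = decidable-stable (_ ≟ _) λ b₁≢b₂ →
          <⇒≱ (F<3 _ (InE-edge a∈ z∈ az)) (3≤cardF z∈ a∈ az b₁∈ b₂∈ ab₁ ab₂ b₁≢b₂)

        edge-lower-injective : ∀ {a₁ a₂} → InBi (suc i) a₁ → InBi (suc i) a₂ →
                                   edge a₁ (lower a₁) ≡ edge a₂ (lower a₂) → a₁ ≡ a₂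
        edge-lower-injective a₁∈ a₂∈ eq = [ proj₁ , (λ (a₁≡z₂ , _) →
          contradiction (sym a₁≡z₂) (InBi-<⇒≢ (proj₁ (lower-spec a₂∈)) a₁∈ (n<1+n i))) ]′ (edge-injective eq)

        descend-injective : (∀ e → InE i e → cardF G e < 3) →
                            ∀ {e₁ e₂} → InE (suc i) e₁ → InE (suc i) e₂ → descend e₁ ≡ descend e₂ → e₁ ≡ e₂
        descend-injective F<3 {e₁} {e₂} ie₁ ie₂ eq =
          let a₁∈ , b₁ , b₁∈ , a₁b₁ , e₁≡ = upper-spec ie₁
              a₂∈ , b₂ , b₂∈ , a₂b₂ , e₂≡ = upper-spec ie₂
              a₁≡a₂ = edge-lower-injective a₁∈ a₂∈ eq
              a₁b₂ = subst (λ a → Adj G a b₂) (sym a₁≡a₂) a₂b₂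
          in begin
            e₁                ≡⟨ e₁≡ ⟩
            edge (upper e₁) b₁ ≡⟨ cong₂ edge a₁≡a₂ (upper-neighbour-unique F<3 a₁∈ b₁∈ b₂∈ a₁b₁ a₁b₂) ⟩
            edge (upper e₂) b₂ ≡⟨ e₂≡ ⟨
            e₂                ∎
          where open ≡-Reasoning

        cardE-suc≤cardE : (∀ e → InE i e → cardF G e < 3) → cardE (suc i) ≤ cardE i
        cardE-suc≤cardE F<3 = injection⇒length-≤ descend
          (Unique.filter⁺ (inE? (suc i)) edges-unique)
          (λ e∈ → InE⇒∈ (descend-InE (∈⇒InE e∈)))
          (λ e₁∈ e₂∈ → descend-injective F<3 (∈⇒InE e₁∈) (∈⇒InE e₂∈))
          where
          ∈⇒InE : ∀ {e} → e ∈ₗ filter (inE? (suc i)) (edges G) → InE (suc i) e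
          ∈⇒InE e∈ = proj₂ (∈-filter⁻ (inE? (suc i)) {xs = edges G} e∈)
          InE⇒∈ : ∀ {e} → InE i e → e ∈ₗ filter (inE? i) (edges G)
          InE⇒∈ ie = ∈-filter⁺ (inE? i) (IsEdge⇒∈edges (proj₁ ie)) ie

corollary1 : ∀ {n : ℕ} (G : Graph n) → C4Free G →
    (∀ e → IsEdge G e → cardF G e ≤ 3) →
    ∀ (u v w : Fin n) → Adj G u v → Adj G v w → ¬ Adj G u w →
    ∀ (i : ℕ) → Layers.AtMostJ G u v w (suc i) →
    Layers.cardE G u v w (suc i) ≤ Layers.cardE G u v w i
corollary1 G _ cardF≤3 u v w _ _ _ i i≤j = cardE-suc≤cardE G u v w cardF≤3 i (i≤j i (n<1+n i))
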